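{- Let $k\ge 2$, let $f\colon\{0,1\}^n\to\{0,1\}$ with $f\in Q_k$, and let $\pi$ be a $k$-party dag-like protocol which strongly computes the $Q_k$-communication game for $f$, with set of terminals $T$. Let $\mathcal Z\subseteq f^{ -1}(0)$ and suppose $M\colon[k]^k\to T$ is complete for $\mathcal Z$. Let $l$ be the output label of $\pi$ at the terminal $M[1,2,\dots,k]$. Then $z_l=0$ for every $z\in\mathcal Z$.
   Context: $Q_k$ is the set of $f$ such that any $x^1,\dots,x^k\in f^{ -1}(0)$ have a coordinate $i$ with $x^1_i=\dots=x^k_i=0$. A $k$-party dag-like protocol with inputs from $f^{ -1}(0)^k$ and outputs in $[n]$ is $\pi=\langle G,P_1,\dots,P_k,\phi_1,\dots,\phi_k,\lambda\rangle$: $G$ a finite directed acyclic multigraph with starting node $s$ from which all nodes are reachable, each non-terminal node having exactly two outgoing edges labeled $0$ and $1$; $P_1,\dots,P_k$ partition the non-terminal nodes; $\phi_i\colon P_i\times f^{ -1}(0)\to\{0,1\}$; $\lambda$ maps terminals to $[n]$ (the output label). An $x$ is $i$-compatible with an edge $e$ from $v$ if $v\notin P_i$ or $e$ is labeled $\phi_i(v,x)$; with a path if with all its edges; with a node $v$ if some path from $s$ to $v$ is $i$-compatible with $x$. $\pi$ strongly computes the $Q_k$-communication game for $f$ if for every terminal $t$, every $x\in f^{ -1}(0)$ and every $i\in[k]$: if $x$ is $i$-compatible with $t$ then $x_{\lambda(t)}=0$. For $M\colon[k]^k\to V$ ($V$ the node set), write $M[c_1,\dots,c_k]$ for its value. A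 function $g\colon\mathcal Z\to[k]$ is complete for $\mathcal Z$ with respect to $M$ if for every $(c_1,\dots,c_k)\in[k]^k$, every $i\in[k]$ and every $z\in\mathcal Z$ with $c_i=g(z)$, $z$ is $i$-compatible with $M[c_1,\dots,c_k]$. $M$ is complete for $\mathcal Z$ if some $g\colon\mathcal Z\to[k]$ is complete for $\mathcal Z$ with respect to $M$. -}

module Defs where

open import Data.Nat using (ℕ)
open import Data.Fin using (Fin)
open import Data.Bool using (Bool; true; false)
open import Data.Product using (Σ; ∃; _×_; proj₁)
open import Data.Sum using (_⊎_)
open import Relation.Binary.PropositionalEquality using (_≡_; _≢_)
open import Relation.Nullary using (¬_)

-- Boolean functions f : {0,1}^n → {0,1}; inputs are Fin n → Bool, 0 = false.
BoolFun : ℕ → Set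
BoolFun n = (Fin n → Bool) → Bool

Zero : {n : ℕ} → BoolFun n → Set
Zero {n} f = Σ (Fin n → Bool) (λ x → f x ≡ false)

InQ : (k : ℕ) {n : ℕ} → BoolFun n → Set
InQ k {n} f = (xs : Fin k → Zero f) → ∃ λ (i : Fin n) → (j : Fin k) → proj₁ (xs j) i ≡ false

-- A node of a protocol on node set Fin N: either a terminal with output
-- label in [n], or a non-terminal owned by party `owner` (this gives the
-- partition P₁,…,P_k) with the target of its 0-edge and of its 1-edge.
data NodeKind (n k N : ℕ) : Set where
  terminal : Fin n → NodeKind n k N
  inner    : (owner : Fin k) (e0 e1 : Fin N) → NodeKind n k N

sel : {A : Set} → Bool → A → A → A
sel false a0 a1 = a0
sel true  a0 a1 = a1

data Path {n k N : ℕ} (node : Fin N → NodeKind n k N) : Fin N → Fin N → Set where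
  here : ∀ {u} → Path node u u
  step : ∀ {u w j v0 v1} → node u ≡ inner j v0 v1 → (b : Bool) →
         Path node (sel b v0 v1) w → Path node u w

NonEmptyPath : {n k N : ℕ} (node : Fin N → NodeKind n k N) → Fin N → Fin N → Set
NonEmptyPath {N = N} node u w =
  ∃ λ j → ∃ λ (v0 : Fin N) → ∃ λ (v1 : Fin N) →
    node u ≡ inner j v0 v1 × ∃ λ (b : Bool) → Path node (sel b v0 v1) w

record Protocol (n k : ℕ) (f : BoolFun n) : Set where
  field
    N       : ℕ
    start   : Fin N
    node    : Fin N → NodeKind n k N
    φ       : Fin k → Fin N → Zero f → Bool   -- φ i is used only on P_i
    acyclic : (v : Fin N) → ¬ NonEmptyPath node v v
    reach   : (v : Fin N) → Path node start v

module _ {n k : ℕ} {f : BoolFun n} (π : Protocol n k f) where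
  open Protocol π

  data CompPath (i : Fin k) (x : Zero f) : Fin N → Fin N → Set where
    here : ∀ {u} → CompPath i x u u
    step : ∀ {u w j v0 v1} → node u ≡ inner j v0 v1 → (b : Bool) →
           (j ≢ i ⊎ b ≡ φ i u x) →
           CompPath i x (sel b v0 v1) w → CompPath i x u w

  Compatible : Fin k → Zero f → Fin N → Set
  Compatible i x v = CompPath i x start v

  StronglyComputes : Set
  StronglyComputes = (t : Fin N) (l : Fin n) → node t ≡ terminal l →
    (x : Zero f) (i : Fin k) → Compatible i x t → proj₁ x l ≡ false

  IsTerminal : Fin N → Set
  IsTerminal t = ∃ λ (l : Fin n) → node t ≡ terminal l

  -- g : 𝒵 → [k] is complete for 𝒵 w.r.t. M  (𝒵 given as a predicate on f⁻¹(0))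
  CompleteWrt : (Z : Zero f → Set) → ((Fin k → Fin k) → Fin N) →
                ((z : Zero f) → Z z → Fin k) → Set
  CompleteWrt Z M g = (c : Fin k → Fin k) (i : Fin k) (z : Zero f) (zZ : Z z) →
    c i ≡ g z zZ → Compatible i z (M c)

  Complete : (Z : Zero f → Set) → ((Fin k → Fin k) → Fin N) → Set
  Complete Z M = Σ ((z : Zero f) → Z z → Fin k) (CompleteWrt Z M)

module Submission where

-- Let g be a function witnessing that M is complete
-- for 𝒵.  For z ∈ 𝒵, completeness gives i-compatibility of z with M[c]
-- for every index tuple c whose i-th entry is i = g(z).  The identity
-- tuple (1,2,…,k) has this property at every position, so every z ∈ 𝒵
-- is g(z)-compatible with the terminal M[1,…,k].  Since π strongly
-- computes the Q_k-game, a terminal compatible with z (for any party)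
-- outputs a coordinate where z is 0; hence z_l = 0 for its label l.
--
-- The hypotheses k ≥ 2, f ∈ Q_k and "M takes terminal values" are part
-- of the paper's setting but are not needed for this conclusion.

open import Defs
open import Data.Nat using (ℕ; _≥_)
open import Data.Fin using (Fin)
open import Data.Bool using (false)
open import Data.Product using (proj₁; _,_)
open import Relation.Binary.PropositionalEquality using (_≡_; refl)
open import Function using (id)

module _ {n k : ℕ} {f : BoolFun n} (π : Protocol n k f) where
  open Protocol π

  compatible-at-fixed-point :
    (Z : Zero f → Set) (M : (Fin k → Fin k) → Fin N)
    (g : (z : Zero f) → Z z → Fin k) → CompleteWrt π Z M g →
    (c : Fin k → Fin k) (z : Zero f) (zZ : Z z) →
    c (g z zZ) ≡ g z zZ → Compatible π (g z zZ) z (M c)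
  compatible-at-fixed-point Z M g complete c z zZ fixes =
    complete c (g z zZ) z zZ fixes

  compatible-with-diagonal :
    (Z : Zero f → Set) (M : (Fin k → Fin k) → Fin N) →
    (complete : Complete π Z M) (z : Zero f) (zZ : Z z) →
    Compatible π (proj₁ complete z zZ) z (M id)
  compatible-with-diagonal Z M (g , complete) z zZ =
    compatible-at-fixed-point Z M g complete id z zZ refl

lemma5 : (n k : ℕ) → k ≥ 2 → (f : BoolFun n) → InQ k f →
    (π : Protocol n k f) → StronglyComputes π →
    (Z : Zero f → Set) → (M : (Fin k → Fin k) → Fin (Protocol.N π)) →
    ((c : Fin k → Fin k) → IsTerminal π (M c)) →
    Complete π Z M →
    (l : Fin n) → Protocol.node π (M id) ≡ terminal l →
    (z : Zero f) → Z z → proj₁ z l ≡ false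
lemma5 n k _ f _ π strong Z M _ complete l diagonal-label z zZ =
  strong (M id) l diagonal-label z (proj₁ complete z zZ)
    (compatible-with-diagonal π Z M complete z zZ)
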